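{- Let $q$ be a prime number and let $\omega_q=w_0w_1w_2\cdots$ be the generalized Thue-Morse word over $\Sigma_q=\{0,\dots,q-1\}$, defined by $w_i=s_q(i)$ (the sum modulo $q$ of the base-$q$ digits of $i$). For every positive integer $n$ and every positive integer $d< q^n-1$, every arithmetic progression with difference $d$ in $\omega_q$ has length at most $q^n$; that is, there are no $c\ge 0$ with $w_c=w_{c+d}=\cdots=w_{c+q^n d}$.
   Context: An arithmetic progression with initial number $c$ and difference $d$ in $\omega_q$ of length $k$ is a constant word $w_cw_{c+d}\cdots w_{c+(k-1)d}$. -}

module Defs where

open import Data.Nat using (ℕ; zero; suc; _+_; _*_; _≤_; _<_; _^_; NonZero)
open import Data.Nat.DivMod using (_/_; _%_)
open import Relation.Binary.PropositionalEquality using (_≡_)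

-- Sum of base-q digits of i, computed with fuel (fuel ≥ i suffices,
-- since i / q < i for i > 0 and q ≥ 2).
digitSumFuel : (q : ℕ) .{{_ : NonZero q}} → ℕ → ℕ → ℕ
digitSumFuel q zero    i = 0
digitSumFuel q (suc f) zero = 0
digitSumFuel q (suc f) i@(suc _) = i % q + digitSumFuel q f (i / q)

digitSum : (q : ℕ) .{{_ : NonZero q}} → ℕ → ℕ
digitSum q i = digitSumFuel q i i

s : (q : ℕ) .{{_ : NonZero q}} → ℕ → ℕ
s q i = digitSum q i % q

tm : (q : ℕ) .{{_ : NonZero q}} → ℕ → ℕ
tm = s

IsAP : (q : ℕ) .{{_ : NonZero q}} → (c d k : ℕ) → Set
IsAP q c d k = ∀ j → j < k → tm q (c + j * d) ≡ tm q c

module Submission where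

open import Defs
open import Data.Nat using (ℕ; zero; suc; pred; _+_; _*_; _∸_; _<_; _≤_; _^_; NonZero; z≤n; s≤s; s≤s⁻¹; z<s; _≟_; _<?_; _≤?_; nonTrivial⇒n>1; >-nonZero⁻¹)
open import Data.Nat.Properties
open import Data.Nat.DivMod
open import Data.Nat.Divisibility using (_∣_; divides; _∣?_; ∣-trans; m∣m*n; *-monoʳ-∣; *-cancelˡ-∣; >⇒∤; 1∣_; m%n≡0⇒n∣m)
open import Data.Nat.Induction using (<-rec)
open import Data.Nat.Primality using (Prime; euclidsLemma; prime⇒nonTrivial)
open import Data.Nat.Tactic.RingSolver using (solve-∀)
open import Data.Fin as Fin using (Fin; toℕ; fromℕ<; punchOut)
open import Data.Fin.Properties using (toℕ-fromℕ<; toℕ-injective; toℕ<n; punchOut-injective; injective⇒≤; any?)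
open import Data.Product using (Σ; ∃; _×_; _,_)
open import Data.Sum using (_⊎_; inj₁; inj₂)
open import Data.Empty using (⊥; ⊥-elim)
open import Relation.Binary.PropositionalEquality
open import Relation.Nullary using (¬_; Dec; yes; no; contradiction)
open import Function using (_∘_)
open import Function.Definitions using (Injective)

-- Write ds for the base-q digit sum, so w_i = ds i mod q. Factors q of d are
-- divided out first (Main.ap-quotient), so assume q ∤ d. Terms are written as
-- ρ + X·q^n with ρ < q^n, and then ds splits as ds ρ + ds X (DigitSum.ds-shift).
-- As q is prime and q ∤ d, the indices j < q^n meet every residue ρ modulo q^n
-- (Covering); a step j → j + 1 from residue ρ with ρ + d < q^n leaves X fixed, so
-- ds (ρ + d) ≡ ds ρ (mod q), and ρ = 0 gives ds d ≡ 0. Thus d is additive below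
-- q^n, and such d with nonzero last digit is borderline, d = q^n - q + a
-- (Additivity). For n = 1 this contradicts ds d ≡ 0. Otherwise, with e = q - a,
-- the two steps after the residue e + q or e + 2q both wrap around q^n, and the
-- digit sums of the three terms force e ≡ 1 or a ≡ 0 (mod q)
-- (Progression.Coprime.Borderline).

module Congruence (m : ℕ) .{{_ : NonZero m}} where

  infix 4 _≡ₘ_
  _≡ₘ_ : ℕ → ℕ → Set
  x ≡ₘ y = x % m ≡ y % m

  +-congˡ-≡ₘ : ∀ x {y z} → y ≡ₘ z → x + y ≡ₘ x + z
  +-congˡ-≡ₘ x {y} {z} y≡z = begin
    (x + y) % m              ≡⟨ %-distribˡ-+ x y m ⟩
    (x % m + y % m) % m      ≡⟨ cong (λ r → (x % m + r) % m) y≡z ⟩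
    (x % m + z % m) % m      ≡⟨ %-distribˡ-+ x z m ⟨
    (x + z) % m              ∎
    where open ≡-Reasoning

  private
    absorb : ∀ x y → (x * pred m + (x + y)) % m ≡ y % m
    absorb x y = begin
      (x * pred m + (x + y)) % m  ≡⟨ cong (_% m) (rearrange x y (pred m)) ⟩
      (y + x * suc (pred m)) % m  ≡⟨ cong (λ r → (y + x * r) % m) (suc-pred m) ⟩
      (y + x * m) % m            ≡⟨ [m+kn]%n≡m%n y x m ⟩
      y % m                      ∎
      where
        open ≡-Reasoning
        rearrange : ∀ x y p → x * p + (x + y) ≡ y + x * suc p
        rearrange = solve-∀

  +-cancelˡ-≡ₘ : ∀ x {y z} → x + y ≡ₘ x + z → y ≡ₘ z
  +-cancelˡ-≡ₘ x {y} {z} h =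
    trans (sym (absorb x y)) (trans (+-congˡ-≡ₘ (x * pred m) h) (absorb x z))

  +-cancelʳ-≡ₘ : ∀ x {y z} → y + x ≡ₘ z + x → y ≡ₘ z
  +-cancelʳ-≡ₘ x {y} {z} h = +-cancelˡ-≡ₘ x (subst₂ _≡ₘ_ (+-comm y x) (+-comm z x) h)

  ≡ₘ⇒≡ : ∀ {x y} → x < m → y < m → x ≡ₘ y → x ≡ y
  ≡ₘ⇒≡ x<m y<m h = trans (sym (m<n⇒m%n≡m x<m)) (trans h (m<n⇒m%n≡m y<m))

  ≡ₘ-shift⇒∣ : ∀ x y → x + y ≡ₘ x → m ∣ y
  ≡ₘ-shift⇒∣ x y h = m%n≡0⇒n∣m y m
    (trans (+-cancelˡ-≡ₘ x (trans h (cong (_% m) (sym (+-identityʳ x))))) (m<n⇒m%n≡m (>-nonZero⁻¹ m)))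

module DigitSum (q : ℕ) .{{_ : NonZero q}} (1<q : 1 < q) where

  open Congruence q public

  ds : ℕ → ℕ
  ds = digitSum q

  fuel-irrelevant : ∀ f g i → i ≤ f → i ≤ g → digitSumFuel q f i ≡ digitSumFuel q g i
  fuel-irrelevant zero    zero    i       _        _        = refl
  fuel-irrelevant zero    (suc g) zero    _        _        = refl
  fuel-irrelevant (suc f) zero    zero    _        _        = refl
  fuel-irrelevant (suc f) (suc g) zero    _        _        = refl
  fuel-irrelevant (suc f) (suc g) (suc i) (s≤s i≤f) (s≤s i≤g) =
    cong (suc i % q +_) (fuel-irrelevant f g (suc i / q) (≤-trans quot≤ i≤f) (≤-trans quot≤ i≤g))
    where
      quot≤ : suc i / q ≤ i
      quot≤ = s≤s⁻¹ (m/n<m (suc i) q 1<q)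

  ds-unfold : ∀ i → 0 < i → ds i ≡ i % q + ds (i / q)
  ds-unfold (suc i) _ =
    cong (suc i % q +_) (fuel-irrelevant i (suc i / q) (suc i / q) (s≤s⁻¹ (m/n<m (suc i) q 1<q)) ≤-refl)

  private
    ds-digit⁺ : ∀ a Y → a < q → 0 < a + Y * q → ds (a + Y * q) ≡ a + ds Y
    ds-digit⁺ a Y a<q pos = begin
      ds (a + Y * q)                          ≡⟨ ds-unfold _ pos ⟩
      (a + Y * q) % q + ds ((a + Y * q) / q)  ≡⟨ cong₂ _+_ last rest ⟩
      a + ds Y                                ∎
      where
        open ≡-Reasoning
        last : (a + Y * q) % q ≡ a
        last = trans ([m+kn]%n≡m%n a Y q) (m<n⇒m%n≡m a<q)
        rest : ds ((a + Y * q) / q) ≡ ds Y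
        rest = cong ds (trans (+-distrib-/ a (Y * q) (subst (_< q) (sym noWrap) a<q))
                              (cong₂ _+_ (m<n⇒m/n≡0 a<q) (m*n/n≡m Y q)))
          where
            noWrap : a % q + (Y * q) % q ≡ a
            noWrap = trans (cong₂ _+_ (m<n⇒m%n≡m a<q) (m*n%n≡0 Y q)) (+-identityʳ a)

  ds-digit : ∀ a Y → a < q → ds (a + Y * q) ≡ a + ds Y
  ds-digit zero    zero    _   = refl
  ds-digit zero    (suc Y) a<q = ds-digit⁺ zero (suc Y) a<q (≤-trans (<⇒≤ 1<q) (m≤m+n q (Y * q)))
  ds-digit (suc a) Y       a<q = ds-digit⁺ (suc a) Y a<q z<s

  ds-split : ∀ X → ds X ≡ X % q + ds (X / q)
  ds-split X = trans (cong ds (m≡m%n+[m/n]*n X q)) (ds-digit (X % q) (X / q) (m%n<n X q))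

  ds-small : ∀ a → a < q → ds a ≡ a
  ds-small a a<q = trans (cong ds (sym (+-identityʳ a))) (trans (ds-digit a 0 a<q) (+-identityʳ a))

  ds-*q : ∀ Y → ds (Y * q) ≡ ds Y
  ds-*q Y = ds-digit 0 Y (<-trans z<s 1<q)

  ds-shift : ∀ m X ρ → ρ < q ^ m → ds (ρ + X * q ^ m) ≡ ds ρ + ds X
  ds-shift zero    X zero    _ = cong ds (*-identityʳ X)
  ds-shift zero    X (suc ρ) (s≤s ())
  ds-shift (suc m) X ρ       ρ< = begin
    ds (ρ + X * (q * q ^ m))                    ≡⟨ cong ds (regroup (m≡m%n+[m/n]*n ρ q)) ⟩
    ds (ρ % q + (ρ / q + X * q ^ m) * q)        ≡⟨ ds-digit (ρ % q) (ρ / q + X * q ^ m) (m%n<n ρ q) ⟩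
    ρ % q + ds (ρ / q + X * q ^ m)              ≡⟨ cong (ρ % q +_) (ds-shift m X (ρ / q) quot<) ⟩
    ρ % q + (ds (ρ / q) + ds X)                 ≡⟨ +-assoc (ρ % q) _ _ ⟨
    (ρ % q + ds (ρ / q)) + ds X                 ≡⟨ cong (_+ ds X) (ds-split ρ) ⟨
    ds ρ + ds X                                 ∎
    where
      open ≡-Reasoning
      quot< : ρ / q < q ^ m
      quot< = m<n*o⇒m/o<n (subst (ρ <_) (*-comm q (q ^ m)) ρ<)
      regroup : ρ ≡ ρ % q + ρ / q * q → ρ + X * (q * q ^ m) ≡ ρ % q + (ρ / q + X * q ^ m) * q
      regroup eq = trans (cong (_+ X * (q * q ^ m)) eq) (ring (ρ % q) (ρ / q) X (q ^ m) q)
        where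
          ring : ∀ r t X Q q → (r + t * q) + X * (q * Q) ≡ r + (t + X * Q) * q
          ring = solve-∀

  ds-suc : ∀ X → suc (X % q) < q → ds (suc X) ≡ suc (ds X)
  ds-suc X last< = begin
    ds (suc X)                          ≡⟨ cong (ds ∘ suc) (m≡m%n+[m/n]*n X q) ⟩
    ds (suc (X % q) + X / q * q)        ≡⟨ ds-digit (suc (X % q)) (X / q) last< ⟩
    suc (X % q + ds (X / q))            ≡⟨ cong suc (ds-split X) ⟨
    suc (ds X)                          ∎
    where open ≡-Reasoning

  carry : ∀ X → suc (X % q) ≡ q → suc X ≡ suc (X / q) * q
  carry X last≡ = trans (cong suc (m≡m%n+[m/n]*n X q)) (cong (_+ X / q * q) last≡)

  no-double-carry : ∀ X → ds (suc X) ≡ suc (ds X) ⊎ ds (suc (suc X)) ≡ suc (ds (suc X))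
  no-double-carry X with suc (X % q) <? q
  ... | yes last< = inj₁ (ds-suc X last<)
  ... | no  last≮ = inj₂ (ds-suc (suc X) (subst (λ r → suc r < q) (sym multiple) 1<q))
    where
      multiple : suc X % q ≡ 0
      multiple = trans (cong (_% q) (carry X (≤-antisym (m%n<n X q) (≮⇒≥ last≮)))) (m*n%n≡0 (suc (X / q)) q)

  suc-≢ₘ : ∀ x → ¬ (suc x ≡ₘ x)
  suc-≢ₘ x h = 1+n≢0 (≡ₘ⇒≡ 1<q (<-trans z<s 1<q) (+-cancelˡ-≡ₘ x (subst₂ _≡ₘ_ (+-comm 1 x) (sym (+-identityʳ x)) h)))

module Additivity (q : ℕ) .{{_ : NonZero q}} (1<q : 1 < q) where

  open DigitSum q 1<q

  Additive : ℕ → ℕ → Set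
  Additive N D = ∀ ρ → ρ + D < q ^ N → ds (ρ + D) ≡ₘ ds ρ + ds D

  -- Every digit of D except the last is q - 1, and D has N digits.
  Borderline : ℕ → ℕ → Set
  Borderline N D = Σ ℕ λ N′ → N ≡ suc N′ × suc (D / q) ≡ q ^ N′

  -- Additivity of D below q^(N+1) forces additivity of D / q below q^N
  -- (test D on multiples ρ′·q, where the last digit of D is never carried).
  additive-quotient : ∀ N D → Additive (suc N) D → Additive N (D / q)
  additive-quotient N D additive ρ′ bound =
    +-cancelˡ-≡ₘ (D % q) (subst₂ _≡ₘ_ lhs rhs (additive (ρ′ * q) bound′))
    where
      shape : ρ′ * q + D ≡ D % q + (ρ′ + D / q) * q
      shape = trans (cong (ρ′ * q +_) (m≡m%n+[m/n]*n D q)) (ring ρ′ (D % q) (D / q) q)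
        where
          ring : ∀ r a D′ q → r * q + (a + D′ * q) ≡ a + (r + D′) * q
          ring = solve-∀
      bound′ : ρ′ * q + D < q ^ suc N
      bound′ = begin-strict
        ρ′ * q + D                   ≡⟨ shape ⟩
        D % q + (ρ′ + D / q) * q     <⟨ +-monoˡ-< _ (m%n<n D q) ⟩
        suc (ρ′ + D / q) * q         ≤⟨ *-monoˡ-≤ q bound ⟩
        q ^ N * q                    ≡⟨ *-comm (q ^ N) q ⟩
        q ^ suc N                    ∎
        where open ≤-Reasoning
      lhs : ds (ρ′ * q + D) ≡ D % q + ds (ρ′ + D / q)
      lhs = trans (cong ds shape) (ds-digit (D % q) (ρ′ + D / q) (m%n<n D q))
      rhs : ds (ρ′ * q) + ds D ≡ D % q + (ds ρ′ + ds (D / q))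
      rhs = trans (cong₂ _+_ (ds-*q ρ′) (ds-split D)) (ring (ds ρ′) (D % q) (ds (D / q)))
        where
          ring : ∀ x a y → x + (a + y) ≡ a + (x + y)
          ring = solve-∀

  -- If D has a nonzero last digit a and its second digit is not q - 1, then D is
  -- not additive: for ρ = q - a exactly one carry occurs in ρ + D.
  additive-breaks : ∀ N D → D % q ≢ 0 → suc (D / q) < q ^ N → suc (D / q % q) < q →
                    ¬ Additive (suc N) D
  additive-breaks N D a≢0 quot< noCarry additive =
    suc-≢ₘ (ds (D / q)) (trans (subst₂ _≡ₘ_ lhs rhs (additive ρ bound)) ([m+kn]%n≡m%n (ds (D / q)) 1 q))
    where
      a = D % q
      ρ = q ∸ a
      ρ+a : ρ + a ≡ q
      ρ+a = m∸n+n≡m (<⇒≤ (m%n<n D q))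
      ρ<q : ρ < q
      ρ<q = subst (ρ <_) ρ+a (m<m+n ρ (n≢0⇒n>0 a≢0))
      shape : ρ + D ≡ suc (D / q) * q
      shape = begin
        ρ + D                  ≡⟨ cong (ρ +_) (m≡m%n+[m/n]*n D q) ⟩
        ρ + (a + D / q * q)    ≡⟨ +-assoc ρ a _ ⟨
        ρ + a + D / q * q      ≡⟨ cong (_+ D / q * q) ρ+a ⟩
        suc (D / q) * q        ∎
        where open ≡-Reasoning
      bound : ρ + D < q ^ suc N
      bound = subst₂ _<_ (sym shape) (*-comm (q ^ N) q) (*-monoˡ-< q quot<)
      lhs : ds (ρ + D) ≡ suc (ds (D / q))
      lhs = trans (cong ds shape) (trans (ds-*q (suc (D / q))) (ds-suc (D / q) noCarry))
      rhs : ds ρ + ds D ≡ ds (D / q) + 1 * q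
      rhs = begin
        ds ρ + ds D                  ≡⟨ cong₂ _+_ (ds-small ρ ρ<q) (ds-split D) ⟩
        ρ + (a + ds (D / q))         ≡⟨ +-assoc ρ a _ ⟨
        ρ + a + ds (D / q)           ≡⟨ cong (_+ ds (D / q)) ρ+a ⟩
        q + ds (D / q)               ≡⟨ +-comm q _ ⟩
        ds (D / q) + q               ≡⟨ cong (ds (D / q) +_) (*-identityˡ q) ⟨
        ds (D / q) + 1 * q           ∎
        where open ≡-Reasoning

  quotient-bound : ∀ N D → suc D < q ^ suc N → D / q < q ^ N
  quotient-bound N D D< = m<n*o⇒m/o<n (subst (D <_) (*-comm q (q ^ N)) (<-trans (n<1+n D) D<))

  -- Classification: an additive D with nonzero last digit is borderline.
  -- Induct on N, passing to D / q as long as the second digit of D is q - 1.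
  additive⇒borderline : ∀ N D → D % q ≢ 0 → suc D < q ^ N → Additive N D → Borderline N D
  additive⇒borderline zero    D _   (s≤s ())
  additive⇒borderline (suc N) D a≢0 D< additive with suc (D / q) ≟ q ^ N
  ... | yes top = N , refl , top
  ... | no  ¬top = ⊥-elim (second-digit (suc (D / q % q) <? q))
    where
      quot< : suc (D / q) < q ^ N
      quot< = ≤∧≢⇒< (quotient-bound N D D<) ¬top
      second-digit : Dec (suc (D / q % q) < q) → ⊥
      second-digit (yes noCarry) = additive-breaks N D a≢0 quot< noCarry additive
      second-digit (no  carries) =
        ¬top (lift (additive⇒borderline N (D / q) second≢0 quot< (additive-quotient N D additive)))
        where
          last≡ : suc (D / q % q) ≡ q
          last≡ = ≤-antisym (m%n<n (D / q) q) (≮⇒≥ carries)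
          second≢0 : D / q % q ≢ 0
          second≢0 second≡0 = <-irrefl (trans (cong suc (sym second≡0)) last≡) 1<q
          lift : Borderline N (D / q) → suc (D / q) ≡ q ^ N
          lift (N′ , refl , top′) = begin
            suc (D / q)           ≡⟨ carry (D / q) last≡ ⟩
            suc (D / q / q) * q   ≡⟨ cong (_* q) top′ ⟩
            q ^ N′ * q            ≡⟨ *-comm (q ^ N′) q ⟩
            q ^ suc N′            ∎
            where open ≡-Reasoning

-- An injective endomap of a finite set is surjective: a missed point would
-- let it factor injectively through a set with one element fewer.
injective⇒surjective : ∀ {n} (f : Fin n → Fin n) → Injective _≡_ _≡_ f → ∀ y → ∃ λ x → f x ≡ y
injective⇒surjective {suc n} f f-injective y with any? (λ x → f x Fin.≟ y)
... | yes hit  = hit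
... | no  miss = contradiction (injective⇒≤ avoid-injective) 1+n≰n
  where
    avoid : Fin (suc n) → Fin n
    avoid x = punchOut {i = y} {j = f x} (λ y≡fx → miss (x , sym y≡fx))
    avoid-injective : Injective _≡_ _≡_ avoid
    avoid-injective eq = f-injective (punchOut-injective {i = y} _ _ eq)

module Covering (q : ℕ) .{{_ : NonZero q}} (q-prime : Prime q) (d : ℕ) (q∤d : ¬ q ∣ d) (m : ℕ) where

  M : ℕ
  M = q ^ m

  instance
    M≢0 : NonZero M
    M≢0 = m^n≢0 q m

  open Congruence M

  prime-power-∣ : ∀ k t → q ^ k ∣ t * d → q ^ k ∣ t
  prime-power-∣ zero    t _ = 1∣ t
  prime-power-∣ (suc k) t h with euclidsLemma t d q-prime (∣-trans (m∣m*n (q ^ k)) h)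
  ... | inj₂ q∣d = contradiction q∣d q∤d
  ... | inj₁ (divides t′ refl) =
    subst (q * q ^ k ∣_) (*-comm q t′) (*-monoʳ-∣ q (prime-power-∣ k t′ (*-cancelˡ-∣ q h′)))
    where
      h′ : q * q ^ k ∣ q * (t′ * d)
      h′ = subst (q * q ^ k ∣_) (ring t′ q d) h
        where
          ring : ∀ t′ q d → t′ * q * d ≡ q * (t′ * d)
          ring = solve-∀

  small-multiple : ∀ t → t < M → M ∣ t → t ≡ 0
  small-multiple zero    _   _   = refl
  small-multiple (suc t) t<M M∣t = contradiction M∣t (>⇒∤ t<M)

  residue-injective-≤ : ∀ c i j → i ≤ j → j < M → c + i * d ≡ₘ c + j * d → i ≡ j
  residue-injective-≤ c i j i≤j j<M h = trans (sym (+-identityʳ i)) (trans (cong (i +_) (sym gap≡0)) i+gap)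
    where
      gap = j ∸ i
      i+gap : i + gap ≡ j
      i+gap = m+[n∸m]≡n i≤j
      step : c + j * d ≡ (c + i * d) + gap * d
      step = trans (cong (λ k → c + k * d) (sym i+gap)) (ring c i gap d)
        where
          ring : ∀ c i t d → c + (i + t) * d ≡ (c + i * d) + t * d
          ring = solve-∀
      gap≡0 : gap ≡ 0
      gap≡0 = small-multiple gap (≤-<-trans (m∸n≤m j i) j<M)
                (prime-power-∣ m gap (≡ₘ-shift⇒∣ (c + i * d) (gap * d) (trans (cong (_% M) (sym step)) (sym h))))

  residue-injective : ∀ c i j → i < M → j < M → c + i * d ≡ₘ c + j * d → i ≡ j
  residue-injective c i j i<M j<M h with ≤-total i j
  ... | inj₁ i≤j = residue-injective-≤ c i j i≤j j<M h
  ... | inj₂ j≤i = sym (residue-injective-≤ c j i j≤i i<M (sym h))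

  cover : ∀ c ρ → ρ < M → ∃ λ j → j < M × (c + j * d) % M ≡ ρ
  cover c ρ ρ<M = let (x , fx≡ρ) = injective⇒surjective residue residue-inj (fromℕ< ρ<M) in
    toℕ x , toℕ<n x , trans (sym (toℕ-fromℕ< (m%n<n _ M))) (trans (cong toℕ fx≡ρ) (toℕ-fromℕ< ρ<M))
    where
      residue : Fin M → Fin M
      residue x = fromℕ< (m%n<n (c + toℕ x * d) M)
      residue-inj : Injective _≡_ _≡_ residue
      residue-inj {x} {y} eq = toℕ-injective (residue-injective c (toℕ x) (toℕ y) (toℕ<n x) (toℕ<n y)
        (trans (sym (toℕ-fromℕ< (m%n<n _ M))) (trans (cong toℕ eq) (toℕ-fromℕ< (m%n<n _ M)))))

module Progression (q : ℕ) .{{_ : NonZero q}} (1<q : 1 < q) (n d c : ℕ) (ap : IsAP q c d (suc (q ^ n))) where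

  open DigitSum q 1<q
  open Additivity q 1<q

  M : ℕ
  M = q ^ n

  instance
    M≢0 : NonZero M
    M≢0 = m^n≢0 q n

  decompose : ∀ j {ρ} → (c + j * d) % M ≡ ρ → c + j * d ≡ ρ + (c + j * d) / M * M
  decompose j r≡ρ = trans (m≡m%n+[m/n]*n _ M) (cong (_+ _) r≡ρ)

  next-term : ∀ j {ρ} X ρ′ t → c + j * d ≡ ρ + X * M → ρ + d ≡ ρ′ + t * M →
              c + suc j * d ≡ ρ′ + (t + X) * M
  next-term j {ρ} X ρ′ t pos wrap = begin
    c + suc j * d        ≡⟨ ring₁ c j d ⟩
    (c + j * d) + d      ≡⟨ cong (_+ d) pos ⟩
    (ρ + X * M) + d      ≡⟨ ring₂ ρ X M d ⟩
    (ρ + d) + X * M      ≡⟨ cong (_+ X * M) wrap ⟩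
    ρ′ + t * M + X * M   ≡⟨ ring₃ ρ′ t X M ⟩
    ρ′ + (t + X) * M     ∎
    where
      open ≡-Reasoning
      ring₁ : ∀ c j d → c + suc j * d ≡ (c + j * d) + d
      ring₁ = solve-∀
      ring₂ : ∀ ρ X M d → (ρ + X * M) + d ≡ (ρ + d) + X * M
      ring₂ = solve-∀
      ring₃ : ∀ ρ t X M → ρ + t * M + X * M ≡ ρ + (t + X) * M
      ring₃ = solve-∀

  term-value : ∀ j {ρ} X → j ≤ M → c + j * d ≡ ρ + X * M → ρ < M → ds ρ + ds X ≡ₘ ds c
  term-value j {ρ} X j≤M pos ρ<M =
    trans (cong (_% q) (sym (trans (cong ds pos) (ds-shift n X ρ ρ<M)))) (ap j (s≤s j≤M))

  -- For prime q with q ∤ d every residue class modulo M is visited, which rules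
  -- the progression out; d + 2 ≤ M is the hypothesis d < q^n - 1.
  module Coprime (q-prime : Prime q) (q∤d : ¬ q ∣ d) (d+2≤M : suc (suc d) ≤ M) where

    open Covering q q-prime d q∤d n using (cover)

    d<M : d < M
    d<M = <-trans (n<1+n d) d+2≤M

    last≢0 : d % q ≢ 0
    last≢0 = q∤d ∘ m%n≡0⇒n∣m d q

    periodic : ∀ ρ → ρ + d < M → ds (ρ + d) ≡ₘ ds ρ
    periodic ρ bound with cover c ρ (≤-<-trans (m≤m+n ρ d) bound)
    ... | j , j<M , r≡ρ = +-cancelʳ-≡ₘ (ds X) (trans value₁ (sym value₀))
      where
        X = (c + j * d) / M
        pos : c + j * d ≡ ρ + X * M
        pos = decompose j r≡ρ
        value₀ : ds ρ + ds X ≡ₘ ds c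
        value₀ = term-value j X (<⇒≤ j<M) pos (≤-<-trans (m≤m+n ρ d) bound)
        value₁ : ds (ρ + d) + ds X ≡ₘ ds c
        value₁ = term-value (suc j) X j<M (next-term j X (ρ + d) 0 pos (sym (+-identityʳ (ρ + d)))) bound

    ds-d≡ₘ0 : ds d ≡ₘ 0
    ds-d≡ₘ0 = periodic 0 d<M

    additive : Additive n d
    additive ρ bound =
      trans (periodic ρ bound) (sym (trans (+-congˡ-≡ₘ (ds ρ) ds-d≡ₘ0) (cong (_% q) (+-identityʳ (ds ρ)))))

    -- The borderline difference d = a + k·q with M = (k + 1)·q, 0 < a ≤ q - 2, k ≥ 2.
    -- With e = q - a we have e + d = M, so from a residue e + (u + 1)·q two
    -- consecutive steps wrap around M; their digit sums cannot all agree.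
    module Borderline (a k : ℕ) (d≡ : d ≡ a + k * q) (M≡ : M ≡ suc k * q)
                      (0<a : 0 < a) (a+2≤q : 2 + a ≤ q) (2≤k : 2 ≤ k) where

      e : ℕ
      e = q ∸ a

      e+a≡q : e + a ≡ q
      e+a≡q = m∸n+n≡m (≤-trans (m≤n+m a 2) a+2≤q)

      a<q : a < q
      a<q = ≤-trans (m≤n+m (suc a) 1) a+2≤q

      e<q : e < q
      e<q = subst (e <_) e+a≡q (m<m+n e 0<a)

      2≤e : 2 ≤ e
      2≤e = +-cancelʳ-≤ a 2 e (subst (2 + a ≤_) (sym e+a≡q) a+2≤q)

      start : ℕ → ℕ
      start u = e + suc u * q

      start< : ∀ u → u ≤ 1 → start u < M
      start< u u≤1 = begin-strict
        e + suc u * q          <⟨ +-monoˡ-< (suc u * q) e<q ⟩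
        suc (suc u) * q        ≤⟨ *-monoˡ-≤ q (s≤s (≤-trans (s≤s u≤1) 2≤k)) ⟩
        suc k * q              ≡⟨ M≡ ⟨
        M                      ∎
        where open ≤-Reasoning

      wrap₁ : ∀ u → start u + d ≡ suc u * q + 1 * M
      wrap₁ u = begin
        e + suc u * q + d                ≡⟨ cong (e + suc u * q +_) d≡ ⟩
        e + suc u * q + (a + k * q)      ≡⟨ ring e a u k q ⟩
        suc u * q + 1 * ((e + a) + k * q) ≡⟨ cong (λ z → suc u * q + 1 * (z + k * q)) e+a≡q ⟩
        suc u * q + 1 * (suc k * q)      ≡⟨ cong (λ z → suc u * q + 1 * z) M≡ ⟨
        suc u * q + 1 * M                ∎
        where
          open ≡-Reasoning
          ring : ∀ e a u k q → e + suc u * q + (a + k * q) ≡ suc u * q + 1 * ((e + a) + k * q)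
          ring = solve-∀

      wrap₂ : ∀ u → suc u * q + d ≡ (a + u * q) + 1 * M
      wrap₂ u = begin
        suc u * q + d                    ≡⟨ cong (suc u * q +_) d≡ ⟩
        suc u * q + (a + k * q)          ≡⟨ ring a u k q ⟩
        (a + u * q) + 1 * (suc k * q)    ≡⟨ cong (λ z → (a + u * q) + 1 * z) M≡ ⟨
        (a + u * q) + 1 * M              ∎
        where
          open ≡-Reasoning
          ring : ∀ a u k q → suc u * q + (a + k * q) ≡ (a + u * q) + 1 * (suc k * q)
          ring = solve-∀

      -- The three terms from start u have digit sums e + (u+1) + ds X,
      -- (u+1) + ds (X+1) and a + u + ds (X+2); since X → X+1 or X+1 → X+2 has
      -- no carry, either e ≡ 1 or a ≡ 0 modulo q — both impossible.
      three-terms : ∀ u → u ≤ 1 → ∀ j → suc (suc j) ≤ M → (c + j * d) % M ≡ start u → ⊥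
      three-terms u u≤1 j j+2≤M r≡start = clash (no-double-carry X)
        where
          X = (c + j * d) / M
          pos₀ : c + j * d ≡ start u + X * M
          pos₀ = decompose j r≡start
          pos₁ : c + suc j * d ≡ suc u * q + suc X * M
          pos₁ = next-term j X (suc u * q) 1 pos₀ (wrap₁ u)
          pos₂ : c + suc (suc j) * d ≡ (a + u * q) + suc (suc X) * M
          pos₂ = next-term (suc j) (suc X) (a + u * q) 1 pos₁ (wrap₂ u)

          mid< : suc u * q < M
          mid< = ≤-<-trans (m≤n+m (suc u * q) e) (start< u u≤1)
          end< : a + u * q < M
          end< = <-trans (+-monoˡ-< (u * q) a<q) mid<
          su<q : suc u < q
          su<q = ≤-trans (s≤s (s≤s u≤1)) (≤-trans (+-monoʳ-≤ 2 0<a) a+2≤q)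

          value₀ : e + suc u + ds X ≡ₘ ds c
          value₀ = subst (λ z → z + ds X ≡ₘ ds c)
                     (trans (ds-digit e (suc u) e<q) (cong (e +_) (ds-small (suc u) su<q)))
                     (term-value j X (≤-trans (n≤1+n j) (≤-trans (n≤1+n (suc j)) j+2≤M)) pos₀ (start< u u≤1))
          value₁ : suc u + ds (suc X) ≡ₘ ds c
          value₁ = subst (λ z → z + ds (suc X) ≡ₘ ds c)
                     (trans (ds-*q (suc u)) (ds-small (suc u) su<q))
                     (term-value (suc j) (suc X) (≤-trans (n≤1+n (suc j)) j+2≤M) pos₁ mid<)
          value₂ : a + u + ds (suc (suc X)) ≡ₘ ds c
          value₂ = subst (λ z → z + ds (suc (suc X)) ≡ₘ ds c)
                     (trans (ds-digit a u a<q) (cong (a +_) (ds-small u (<-trans (n<1+n u) su<q))))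
                     (term-value (suc (suc j)) (suc (suc X)) j+2≤M pos₂ end<)

          clash : ds (suc X) ≡ suc (ds X) ⊎ ds (suc (suc X)) ≡ suc (ds (suc X)) → ⊥
          clash (inj₁ noCarry₁) = <-irrefl (sym e≡1) 2≤e
            where
              e≡1 : e ≡ 1
              e≡1 = ≡ₘ⇒≡ e<q 1<q (+-cancelˡ-≡ₘ (suc u + ds X) (subst₂ _≡ₘ_ (ring₀ e u (ds X)) (ring₁ u (ds X))
                      (trans value₀ (sym (subst (λ z → suc u + z ≡ₘ ds c) noCarry₁ value₁)))))
                where
                  ring₀ : ∀ e u x → e + suc u + x ≡ (suc u + x) + e
                  ring₀ = solve-∀
                  ring₁ : ∀ u x → suc u + suc x ≡ (suc u + x) + 1
                  ring₁ = solve-∀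
          clash (inj₂ noCarry₂) = <-irrefl 0≡a 0<a
            where
              S = ds (suc X)
              0≡a : 0 ≡ a
              0≡a = ≡ₘ⇒≡ (<-trans z<s 1<q) a<q
                      (+-cancelˡ-≡ₘ (suc u + S) (subst₂ _≡ₘ_ (sym (+-identityʳ (suc u + S))) (ring₂ a u S)
                        (trans value₁ (sym (subst (λ z → a + u + z ≡ₘ ds c) noCarry₂ value₂)))))
                where
                  ring₂ : ∀ a u s → a + u + suc s ≡ (suc u + s) + a
                  ring₂ = solve-∀

      -- The residues start 0 and start 1 are both visited by indices below M; at
      -- most one of these indices is the last one, M - 1, so the other has two successors.
      impossible : ⊥
      impossible with cover c (start 0) (start< 0 z≤n) | cover c (start 1) (start< 1 ≤-refl)
      ... | j₀ , j₀<M , r₀ | j₁ , j₁<M , r₁ with suc (suc j₀) ≤? M | suc (suc j₁) ≤? M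
      ...   | yes room₀ | _         = three-terms 0 z≤n j₀ room₀ r₀
      ...   | no  _     | yes room₁ = three-terms 1 ≤-refl j₁ room₁ r₁
      ...   | no  last₀ | no  last₁ = 1+n≢n (sym (*-cancelʳ-≡ 1 2 q (+-cancelˡ-≡ e _ _ same-start)))
        where
          last-index : ∀ {j} → j < M → ¬ suc (suc j) ≤ M → suc j ≡ M
          last-index j<M no-room = ≤-antisym j<M (≮⇒≥ no-room)
          same-start : start 0 ≡ start 1
          same-start = begin
            start 0             ≡⟨ r₀ ⟨
            (c + j₀ * d) % M    ≡⟨ cong (λ j → (c + j * d) % M) (suc-injective (trans (last-index j₀<M last₀) (sym (last-index j₁<M last₁)))) ⟩
            (c + j₁ * d) % M    ≡⟨ r₁ ⟩
            start 1             ∎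
            where open ≡-Reasoning

    -- The coprime case: d is additive, hence borderline; a one-digit borderline d
    -- contradicts ds d ≡ 0, a longer one is ruled out by Borderline.
    no-progression : ⊥
    no-progression with additive⇒borderline n d last≢0 d+2≤M additive
    ... | N′ , n≡ , top = by-length N′ (cong (q ^_) n≡) top
      where
        by-length : ∀ N′ → M ≡ q ^ suc N′ → suc (d / q) ≡ q ^ N′ → ⊥
        by-length zero    _  top =
          last≢0 (trans (cong (_% q) (sym (ds-small d d<q))) (trans ds-d≡ₘ0 (m<n⇒m%n≡m (>-nonZero⁻¹ q))))
          where
            d<q : d < q
            d<q = m/n≡0⇒m<n (suc-injective top)
        by-length (suc N″) M≡ top =
          Borderline.impossible (d % q) (d / q) (m≡m%n+[m/n]*n d q) M≡′ (n≢0⇒n>0 last≢0) a+2≤q 2≤k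
          where
            M≡′ : M ≡ suc (d / q) * q
            M≡′ = trans M≡ (trans (*-comm q (q ^ suc N″)) (cong (_* q) (sym top)))
            a+2≤q : 2 + d % q ≤ q
            a+2≤q = +-cancelʳ-≤ (d / q * q) (2 + d % q) q
                      (subst₂ _≤_ (cong (2 +_) (m≡m%n+[m/n]*n d q)) M≡′ d+2≤M)
            2≤k : 2 ≤ d / q
            2≤k = s≤s⁻¹ (subst (3 ≤_) (sym top) (≤-trans 3≤q (m≤m*n q (q ^ N″) {{m^n≢0 q N″}})))
              where
                3≤q : 3 ≤ q
                3≤q = ≤-trans (+-monoʳ-≤ 2 (n≢0⇒n>0 last≢0)) a+2≤q

module Main (q : ℕ) .{{_ : NonZero q}} (q-prime : Prime q) (n : ℕ) where

  1<q : 1 < q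
  1<q = nonTrivial⇒n>1 q {{prime⇒nonTrivial q-prime}}

  open DigitSum q 1<q

  -- A progression with difference d′·q from c induces one with difference d′
  -- from c / q: all its terms share the last digit of c.
  ap-quotient : ∀ c d′ k → IsAP q c (d′ * q) k → IsAP q (c / q) d′ k
  ap-quotient c d′ k ap j j<k = +-cancelˡ-≡ₘ (c % q) (subst₂ _≡ₘ_ lhs (ds-split c) (ap j j<k))
    where
      shape : c + j * (d′ * q) ≡ c % q + (c / q + j * d′) * q
      shape = trans (cong (_+ j * (d′ * q)) (m≡m%n+[m/n]*n c q)) (ring (c % q) (c / q) j d′ q)
        where
          ring : ∀ r t j d′ q → (r + t * q) + j * (d′ * q) ≡ r + (t + j * d′) * q
          ring = solve-∀
      lhs : ds (c + j * (d′ * q)) ≡ c % q + ds (c / q + j * d′)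
      lhs = trans (cong ds shape) (ds-digit (c % q) (c / q + j * d′) (m%n<n c q))

  no-long-progression : ∀ d → 0 < d → suc (suc d) ≤ q ^ n → ∀ c → ¬ IsAP q c d (suc (q ^ n))
  no-long-progression = <-rec P step
    where
      P : ℕ → Set
      P d = 0 < d → suc (suc d) ≤ q ^ n → ∀ c → ¬ IsAP q c d (suc (q ^ n))
      step : ∀ d → (∀ {d′} → d′ < d → P d′) → P d
      step d rec 0<d bound c ap with q ∣? d
      ... | no  q∤d                 = Progression.Coprime.no-progression q 1<q n d c ap q-prime q∤d bound
      ... | yes (divides zero refl) = <-irrefl refl 0<d
      ... | yes (divides d′@(suc _) refl) =
        rec d′<d z<s (≤-trans (s≤s (s≤s (<⇒≤ d′<d))) bound) (c / q) (ap-quotient c d′ _ ap)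
        where
          d′<d : d′ < d′ * q
          d′<d = m<m*n d′ q 1<q

lemma1 : (q : ℕ) .{{_ : NonZero q}} → Prime q → (n d : ℕ) → 0 < n → 0 < d → d < q ^ n ∸ 1 →
    ∀ c → ¬ IsAP q c d (suc (q ^ n))
lemma1 q q-prime n d _ 0<d d<qⁿ-1 = Main.no-long-progression q q-prime n d 0<d (two-below (q ^ n) d<qⁿ-1)
  where
    two-below : ∀ M → d < M ∸ 1 → suc (suc d) ≤ M
    two-below zero    ()
    two-below (suc M) d<M = s≤s d<M
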